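{- For every positive integer $m\equiv 1\pmod 2$ and every positive integer $t\equiv 0\pmod 2$, there is no $(3,mt;m)$-CHDM.
   Context: Let $Z_v$ denote the integers modulo $v$. A $(k,wt;w)$-CHDM is a $k\times w(t-1)$ matrix $D=(d_{ij})$ with entries in $Z_{wt}$ such that for any two distinct rows $x,y$ the list $\{d_{xj}-d_{yj}: 0\le j\le w(t-1)-1\}$ contains each element of $Z_{wt}\setminus\{0,t,\ldots,(w-1)t\}$ exactly once. -}

module Defs where

open import Data.Nat using (ℕ; zero; suc; _+_; _*_; _∸_; NonZero)
open import Data.Nat.DivMod using (_%_)
open import Data.Nat.Divisibility using (_∣_)
open import Data.Fin using (Fin; toℕ)
open import Data.List using (List; length; filter; map; allFin)
open import Relation.Binary.PropositionalEquality using (_≡_)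
open import Relation.Nullary using (¬_; Dec)
open import Data.Nat using (_≟_)

diffMod : (v : ℕ) → .{{NonZero v}} → Fin v → Fin v → ℕ
diffMod v a b = (toℕ a + (v ∸ toℕ b)) % v

countCols : (n : ℕ) → (Fin n → ℕ) → ℕ → ℕ
countCols n f e = length (filter (λ j → f j ≟ e) (allFin n))

-- The subgroup {0, t, ..., (w-1)t} of Z_{wt} is exactly {e < wt | t ∣ e}.
IsCHDM : (k w t : ℕ) → .{{NonZero (w * t)}} →
         (Fin k → Fin (w * (t ∸ 1)) → Fin (w * t)) → Set
IsCHDM k w t D =
  (x y : Fin k) → ¬ (x ≡ y) →
  let f = λ j → diffMod (w * t) (D x j) (D y j) in
  ((e : Fin (w * t)) → ¬ (t ∣ toℕ e) → countCols (w * (t ∸ 1)) f (toℕ e) ≡ 1)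
  × ((e : Fin (w * t)) → t ∣ toℕ e → countCols (w * (t ∸ 1)) f (toℕ e) ≡ 0)
  where open import Data.Product using (_×_)

-- Write v = mt.  For distinct rows x, y the differences d_xj - d_yj, read as numbers in
-- [0, v), run exactly once through the non-multiples of t below v, so their sum is
-- N = v(v-1)/2 - t·m(m-1)/2 = v(v-m)/2 for every pair of rows.  With three rows,
-- (a - b) + (b - c) ≡ a - c (mod v) columnwise, so N + N ≡ N, i.e. v ∣ N, i.e. v - m = m(t-1)
-- is even.  That fails for m odd and t even.
module Submission where

open import Defs
open import Data.Nat using (ℕ; suc; _*_; _∸_; _%_; NonZero)
open import Data.Fin using (Fin)
open import Relation.Binary.PropositionalEquality using (_≡_)
open import Relation.Nullary using (¬_)

open import Data.Nat using (zero; _+_; _/_; _<_; _≟_; z≤n; s≤s)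
open import Data.Nat.Properties
open import Data.Nat.DivMod using (m≡m%n+[m/n]*n; [m+kn]%n≡m%n; %-distribˡ-+; %-distribˡ-*; m%n<n)
open import Data.Nat.Divisibility using (_∣_; divides; _∣?_; ∣m+n∣m⇒∣n; ∣⇒≤; n∣m*n)
open import Data.Nat.Solver using (module +-*-Solver)
open import Data.Nat.ListAction using (sum)
open import Data.Fin using (zero; suc; toℕ; fromℕ<)
open import Data.Fin.Properties using (toℕ-fromℕ<; toℕ<n)
open import Data.List using (List; []; _∷_; map; filter; length; allFin)
open import Data.List.Properties using (map-cong; filter-accept; filter-reject)
open import Data.Product using (_,_; ∃-syntax; proj₁; proj₂)
open import Data.Sum using (inj₁; inj₂)
open import Function using (_∘_)
open import Relation.Nullary using (Dec; yes; no; ¬?; contradiction)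
open import Relation.Binary.PropositionalEquality using (_≢_; ≢-sym; refl; sym; trans; cong; cong₂; subst; module ≡-Reasoning)

open +-*-Solver using (solve; _:+_; _:*_; _:=_; con)
open ≡-Reasoning

sumBelow : ℕ → (ℕ → ℕ) → ℕ
sumBelow zero    g = 0
sumBelow (suc k) g = sumBelow k g + g k

sumBelow-cong : ∀ k {g h : ℕ → ℕ} → (∀ e → e < k → g e ≡ h e) → sumBelow k g ≡ sumBelow k h
sumBelow-cong zero    g≡h = refl
sumBelow-cong (suc k) g≡h =
  cong₂ _+_ (sumBelow-cong k (λ e e<k → g≡h e (m<n⇒m<1+n e<k))) (g≡h k ≤-refl)

sumBelow-distrib-+ : ∀ k (g h : ℕ → ℕ) →
                     sumBelow k (λ e → g e + h e) ≡ sumBelow k g + sumBelow k h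
sumBelow-distrib-+ zero    g h = refl
sumBelow-distrib-+ (suc k) g h rewrite sumBelow-distrib-+ k g h =
  solve 4 (λ a b c d → (a :+ b) :+ (c :+ d) := (a :+ c) :+ (b :+ d)) refl
    (sumBelow k g) (sumBelow k h) (g k) (h k)

sumBelow-+ : ∀ a b (g : ℕ → ℕ) → sumBelow (a + b) g ≡ sumBelow a g + sumBelow b (λ r → g (a + r))
sumBelow-+ a zero    g rewrite +-identityʳ a = sym (+-identityʳ _)
sumBelow-+ a (suc b) g rewrite +-suc a b | sumBelow-+ a b g = +-assoc (sumBelow a g) _ _

sumBelow-vanishing : ∀ k {g : ℕ → ℕ} → (∀ e → e < k → g e ≡ 0) → sumBelow k g ≡ 0
sumBelow-vanishing k g≡0 = trans (sumBelow-cong k g≡0) (zeros k)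
  where
  zeros : ∀ k → sumBelow k (λ _ → 0) ≡ 0
  zeros zero    = refl
  zeros (suc k) = cong (_+ 0) (zeros k)

sumBelow-point : ∀ k x {g : ℕ → ℕ} → x < k → (∀ e → e < k → e ≢ x → g e ≡ 0) →
                 sumBelow k g ≡ g x
sumBelow-point (suc k) x {g} (s≤s x≤k) g≡0 with m≤n⇒m<n∨m≡n x≤k
... | inj₁ x<k = begin
  sumBelow k g + g k  ≡⟨ cong₂ _+_ (sumBelow-point k x x<k (λ e e<k → g≡0 e (m<n⇒m<1+n e<k)))
                                   (g≡0 k ≤-refl (≢-sym (<⇒≢ x<k))) ⟩
  g x + 0             ≡⟨ +-identityʳ (g x) ⟩
  g x                 ∎
... | inj₂ refl =
  cong (_+ g x) (sumBelow-vanishing k (λ e e<k → g≡0 e (m<n⇒m<1+n e<k) (<⇒≢ e<k)))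

2*sumBelow-id+k≡k*k : ∀ k → 2 * sumBelow k (λ e → e) + k ≡ k * k
2*sumBelow-id+k≡k*k zero    = refl
2*sumBelow-id+k≡k*k (suc k) = begin
  2 * (sumBelow k (λ e → e) + k) + suc k
    ≡⟨ solve 2 (λ s k → con 2 :* (s :+ k) :+ (con 1 :+ k) := (con 2 :* s :+ k) :+ (con 1 :+ con 2 :* k))
             refl (sumBelow k (λ e → e)) k ⟩
  (2 * sumBelow k (λ e → e) + k) + (1 + 2 * k)
    ≡⟨ cong (_+ (1 + 2 * k)) (2*sumBelow-id+k≡k*k k) ⟩
  k * k + (1 + 2 * k)
    ≡⟨ solve 1 (λ k → k :* k :+ (con 1 :+ con 2 :* k) := (con 1 :+ k) :* (con 1 :+ k)) refl k ⟩
  suc k * suc k ∎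

𝟙 : ∀ {p} {P : Set p} → Dec P → ℕ
𝟙 (yes _) = 1
𝟙 (no _)  = 0

*𝟙-yes : ∀ {p} {P : Set p} n (d : Dec P) → P → n * 𝟙 d ≡ n
*𝟙-yes n (yes _) _ = *-identityʳ n
*𝟙-yes n (no ¬p) p = contradiction p ¬p

*𝟙-no : ∀ {p} {P : Set p} n (d : Dec P) → ¬ P → n * 𝟙 d ≡ 0
*𝟙-no n (yes p) ¬p = contradiction p ¬p
*𝟙-no n (no _)  _  = *-zeroʳ n

𝟙¬?+𝟙≡1 : ∀ {p} {P : Set p} (d : Dec P) → 𝟙 (¬? d) + 𝟙 d ≡ 1
𝟙¬?+𝟙≡1 (yes _) = refl
𝟙¬?+𝟙≡1 (no _)  = refl

sumBelow-𝟙≟ : ∀ k x → x < k → sumBelow k (λ e → e * 𝟙 (x ≟ e)) ≡ x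
sumBelow-𝟙≟ k x x<k = begin
  sumBelow k (λ e → e * 𝟙 (x ≟ e))
    ≡⟨ sumBelow-point k x x<k (λ e _ e≢x → *𝟙-no e (x ≟ e) (≢-sym e≢x)) ⟩
  x * 𝟙 (x ≟ x)  ≡⟨ *𝟙-yes x (x ≟ x) refl ⟩
  x              ∎

sum-map-+ : ∀ {a} {A : Set a} (f g : A → ℕ) xs →
            sum (map (λ x → f x + g x) xs) ≡ sum (map f xs) + sum (map g xs)
sum-map-+ f g []       = refl
sum-map-+ f g (x ∷ xs) rewrite sum-map-+ f g xs =
  solve 4 (λ a b c d → (a :+ b) :+ (c :+ d) := (a :+ c) :+ (b :+ d)) refl
    (f x) (g x) (sum (map f xs)) (sum (map g xs))

sum-map-*ˡ : ∀ {a} {A : Set a} v (f : A → ℕ) xs → sum (map (λ x → v * f x) xs) ≡ v * sum (map f xs)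
sum-map-*ˡ v f []       = sym (*-zeroʳ v)
sum-map-*ˡ v f (x ∷ xs) rewrite sum-map-*ˡ v f xs = sym (*-distribˡ-+ v (f x) (sum (map f xs)))

count : ∀ {a} {A : Set a} → (A → ℕ) → ℕ → List A → ℕ
count f e xs = length (filter (λ x → f x ≟ e) xs)

count-∷ : ∀ {a} {A : Set a} (f : A → ℕ) e x xs → count f e (x ∷ xs) ≡ 𝟙 (f x ≟ e) + count f e xs
count-∷ f e x xs with f x ≟ e
... | yes fx≡e = cong length (filter-accept (λ x → f x ≟ e) fx≡e)
... | no  fx≢e = cong length (filter-reject (λ x → f x ≟ e) fx≢e)

sum≡sumBelow-count : ∀ {a} {A : Set a} v (f : A → ℕ) → (∀ x → f x < v) → ∀ xs →
                     sum (map f xs) ≡ sumBelow v (λ e → e * count f e xs)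
sum≡sumBelow-count v f f<v []       = sym (sumBelow-vanishing v (λ e _ → *-zeroʳ e))
sum≡sumBelow-count v f f<v (x ∷ xs) = begin
  f x + sum (map f xs)
    ≡⟨ cong₂ _+_ (sym (sumBelow-𝟙≟ v (f x) (f<v x))) (sum≡sumBelow-count v f f<v xs) ⟩
  sumBelow v (λ e → e * 𝟙 (f x ≟ e)) + sumBelow v (λ e → e * count f e xs)
    ≡⟨ sym (sumBelow-distrib-+ v _ _) ⟩
  sumBelow v (λ e → e * 𝟙 (f x ≟ e) + e * count f e xs)
    ≡⟨ sumBelow-cong v (λ e _ → trans (sym (*-distribˡ-+ e _ _)) (cong (e *_) (sym (count-∷ f e x xs)))) ⟩
  sumBelow v (λ e → e * count f e (x ∷ xs)) ∎

sumMultiples sumNonMultiples : ℕ → ℕ → ℕ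
sumMultiples    t v = sumBelow v (λ e → e * 𝟙 (t ∣? e))
sumNonMultiples t v = sumBelow v (λ e → e * 𝟙 (¬? (t ∣? e)))

sumNonMultiples+sumMultiples : ∀ t v →
                               sumNonMultiples t v + sumMultiples t v ≡ sumBelow v (λ e → e)
sumNonMultiples+sumMultiples t v = begin
  sumNonMultiples t v + sumMultiples t v
    ≡⟨ sym (sumBelow-distrib-+ v _ _) ⟩
  sumBelow v (λ e → e * 𝟙 (¬? (t ∣? e)) + e * 𝟙 (t ∣? e))
    ≡⟨ sumBelow-cong v (λ e _ → begin
         e * 𝟙 (¬? (t ∣? e)) + e * 𝟙 (t ∣? e)  ≡⟨ sym (*-distribˡ-+ e _ _) ⟩
         e * (𝟙 (¬? (t ∣? e)) + 𝟙 (t ∣? e))    ≡⟨ cong (e *_) (𝟙¬?+𝟙≡1 (t ∣? e)) ⟩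
         e * 1                                ≡⟨ *-identityʳ e ⟩
         e                                    ∎) ⟩
  sumBelow v (λ e → e) ∎

-- In the block [qt, qt + t) only qt is a multiple of t.
sumMultiples-block : ∀ q t → sumBelow t (λ r → (q * t + r) * 𝟙 (t ∣? (q * t + r))) ≡ q * t
sumMultiples-block q zero    = sym (*-zeroʳ q)
sumMultiples-block q t@(suc _) = begin
  sumBelow t (λ r → (q * t + r) * 𝟙 (t ∣? (q * t + r)))
    ≡⟨ sumBelow-point t 0 (s≤s z≤n) (λ r r<t r≢0 →
         *𝟙-no (q * t + r) (t ∣? (q * t + r)) (not-multiple r<t r≢0)) ⟩
  (q * t + 0) * 𝟙 (t ∣? (q * t + 0))
    ≡⟨ cong (λ e → e * 𝟙 (t ∣? e)) (+-identityʳ (q * t)) ⟩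
  q * t * 𝟙 (t ∣? (q * t))
    ≡⟨ *𝟙-yes (q * t) (t ∣? (q * t)) (n∣m*n q) ⟩
  q * t ∎
  where
  not-multiple : ∀ {r} → r < t → r ≢ 0 → ¬ t ∣ q * t + r
  not-multiple {zero}  _   r≢0 = contradiction refl r≢0
  not-multiple {suc _} r<t _   t∣ = <-irrefl refl (<-≤-trans r<t (∣⇒≤ (∣m+n∣m⇒∣n t∣ (n∣m*n q))))

2*sumMultiples+mt≡m*m*t : ∀ m t → 2 * sumMultiples t (m * t) + m * t ≡ m * m * t
2*sumMultiples+mt≡m*m*t zero    t = refl
2*sumMultiples+mt≡m*m*t (suc m) t = begin
  2 * M (t + m * t) + suc m * t
    ≡⟨ cong (λ z → 2 * M z + suc m * t) (+-comm t (m * t)) ⟩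
  2 * M (m * t + t) + suc m * t
    ≡⟨ cong (λ z → 2 * z + suc m * t)
            (trans (sumBelow-+ (m * t) t _) (cong (M (m * t) +_) (sumMultiples-block m t))) ⟩
  2 * (M (m * t) + m * t) + suc m * t
    ≡⟨ solve 3 (λ M m t → con 2 :* (M :+ m :* t) :+ (con 1 :+ m) :* t
                        := (con 2 :* M :+ m :* t) :+ (con 2 :* m :* t :+ t)) refl (M (m * t)) m t ⟩
  (2 * M (m * t) + m * t) + (2 * m * t + t)
    ≡⟨ cong (_+ (2 * m * t + t)) (2*sumMultiples+mt≡m*m*t m t) ⟩
  m * m * t + (2 * m * t + t)
    ≡⟨ solve 2 (λ m t → m :* m :* t :+ (con 2 :* m :* t :+ t) := (con 1 :+ m) :* (con 1 :+ m) :* t) refl m t ⟩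
  suc m * suc m * t ∎
  where
  M : ℕ → ℕ
  M = sumMultiples t

2*sumNonMultiples+m*v≡v*v : ∀ m t → let v = m * t in 2 * sumNonMultiples t v + m * v ≡ v * v
2*sumNonMultiples+m*v≡v*v m t = begin
  2 * N + m * v
    ≡⟨ cong (2 * N +_) (trans (sym (*-assoc m m t)) (sym (2*sumMultiples+mt≡m*m*t m t))) ⟩
  2 * N + (2 * M + v)
    ≡⟨ solve 3 (λ N M v → con 2 :* N :+ (con 2 :* M :+ v) := con 2 :* (N :+ M) :+ v) refl N M v ⟩
  2 * (N + M) + v
    ≡⟨ cong (λ s → 2 * s + v) (sumNonMultiples+sumMultiples t v) ⟩
  2 * sumBelow v (λ e → e) + v
    ≡⟨ 2*sumBelow-id+k≡k*k v ⟩
  v * v ∎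
  where
  v = m * t
  N = sumNonMultiples t v
  M = sumMultiples t v

diffMod-trans : ∀ v .{{_ : NonZero v}} (a b c : Fin v) →
                (diffMod v a b + diffMod v b c) % v ≡ diffMod v a c
diffMod-trans v a b c = begin
  ((x + (v ∸ y)) % v + (y + (v ∸ z)) % v) % v   ≡⟨ sym (%-distribˡ-+ (x + (v ∸ y)) (y + (v ∸ z)) v) ⟩
  ((x + (v ∸ y)) + (y + (v ∸ z))) % v
    ≡⟨ cong (_% v) (solve 4 (λ x p y q → (x :+ p) :+ (y :+ q) := (x :+ q) :+ (p :+ y)) refl x (v ∸ y) y (v ∸ z)) ⟩
  ((x + (v ∸ z)) + ((v ∸ y) + y)) % v
    ≡⟨ cong (λ u → ((x + (v ∸ z)) + u) % v) (trans (m∸n+n≡m (<⇒≤ (toℕ<n b))) (sym (*-identityˡ v))) ⟩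
  ((x + (v ∸ z)) + 1 * v) % v                   ≡⟨ [m+kn]%n≡m%n (x + (v ∸ z)) 1 v ⟩
  (x + (v ∸ z)) % v                             ∎
  where
  x = toℕ a
  y = toℕ b
  z = toℕ c

sum-mod-additive : ∀ {a} {A : Set a} v .{{_ : NonZero v}} (f g h : A → ℕ) →
                   (∀ x → (f x + g x) % v ≡ h x) → ∀ xs →
                   sum (map f xs) + sum (map g xs) ≡ sum (map h xs) + v * sum (map (λ x → (f x + g x) / v) xs)
sum-mod-additive v f g h f+g≡h xs = begin
  sum (map f xs) + sum (map g xs)                    ≡⟨ sym (sum-map-+ f g xs) ⟩
  sum (map (λ x → f x + g x) xs)                     ≡⟨ cong sum (map-cong division xs) ⟩
  sum (map (λ x → h x + v * q x) xs)                 ≡⟨ sum-map-+ h (λ x → v * q x) xs ⟩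
  sum (map h xs) + sum (map (λ x → v * q x) xs)      ≡⟨ cong (sum (map h xs) +_) (sum-map-*ˡ v q xs) ⟩
  sum (map h xs) + v * sum (map q xs)                ∎
  where
  q = λ x → (f x + g x) / v
  division : ∀ x → f x + g x ≡ h x + v * q x
  division x = trans (m≡m%n+[m/n]*n (f x + g x) v) (cong₂ _+_ (f+g≡h x) (*-comm (q x) v))

module _ {k w t : ℕ} .{{_ : NonZero (w * t)}}
         (D : Fin k → Fin (w * (t ∸ 1)) → Fin (w * t)) (chdm : IsCHDM k w t D) where

  private
    v = w * t
    columns = allFin (w * (t ∸ 1))

  rowDiff : Fin k → Fin k → Fin (w * (t ∸ 1)) → ℕ
  rowDiff x y j = diffMod v (D x j) (D y j)

  sum-rowDiff : ∀ x y → x ≢ y → sum (map (rowDiff x y) columns) ≡ sumNonMultiples t v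
  sum-rowDiff x y x≢y = begin
    sum (map (rowDiff x y) columns)
      ≡⟨ sum≡sumBelow-count v (rowDiff x y) (λ j → m%n<n _ v) columns ⟩
    sumBelow v (λ e → e * count (rowDiff x y) e columns)
      ≡⟨ sumBelow-cong v (λ e e<v → cong (e *_) (count≡𝟙 e<v (t ∣? e))) ⟩
    sumNonMultiples t v ∎
    where
    count≡𝟙 : ∀ {e} (e<v : e < v) (d : Dec (t ∣ e)) → count (rowDiff x y) e columns ≡ 𝟙 (¬? d)
    count≡𝟙 e<v (yes t∣e) = subst (λ z → count (rowDiff x y) z columns ≡ 0) (toℕ-fromℕ< e<v)
      (proj₂ (chdm x y x≢y) (fromℕ< e<v) (subst (t ∣_) (sym (toℕ-fromℕ< e<v)) t∣e))
    count≡𝟙 e<v (no t∤e) = subst (λ z → count (rowDiff x y) z columns ≡ 1) (toℕ-fromℕ< e<v)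
      (proj₁ (chdm x y x≢y) (fromℕ< e<v) (t∤e ∘ subst (t ∣_) (toℕ-fromℕ< e<v)))

  divides-sumNonMultiples : (x y z : Fin k) → x ≢ y → y ≢ z → x ≢ z → v ∣ sumNonMultiples t v
  divides-sumNonMultiples x y z x≢y y≢z x≢z = divides Q (trans N≡v*Q (*-comm v Q))
    where
    Q = sum (map (λ j → (rowDiff x y j + rowDiff y z j) / v) columns)
    N≡v*Q : sumNonMultiples t v ≡ v * Q
    N≡v*Q = +-cancelˡ-≡ (sumNonMultiples t v) _ _ (begin
      sumNonMultiples t v + sumNonMultiples t v
        ≡⟨ sym (cong₂ _+_ (sum-rowDiff x y x≢y) (sum-rowDiff y z y≢z)) ⟩
      sum (map (rowDiff x y) columns) + sum (map (rowDiff y z) columns)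
        ≡⟨ sum-mod-additive v (rowDiff x y) (rowDiff y z) (rowDiff x z)
             (λ j → diffMod-trans v (D x j) (D y j) (D z j)) columns ⟩
      sum (map (rowDiff x z) columns) + v * Q
        ≡⟨ cong (_+ v * Q) (sum-rowDiff x z x≢z) ⟩
      sumNonMultiples t v + v * Q ∎)

mt∣sumNonMultiples⇒mt∸m-even : ∀ m t .{{_ : NonZero (m * t)}} → m * t ∣ sumNonMultiples t (m * t) →
                               ∃[ q ] 2 * q + m ≡ m * t
mt∣sumNonMultiples⇒mt∸m-even m t (divides q N≡q*v) = q , *-cancelˡ-≡ (2 * q + m) v v (begin
  v * (2 * q + m)
    ≡⟨ solve 3 (λ v q m → v :* (con 2 :* q :+ m) := con 2 :* (q :* v) :+ m :* v) refl v q m ⟩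
  2 * (q * v) + m * v
    ≡⟨ cong (λ N → 2 * N + m * v) (sym N≡q*v) ⟩
  2 * sumNonMultiples t v + m * v
    ≡⟨ 2*sumNonMultiples+m*v≡v*v m t ⟩
  v * v ∎)
  where
  v = m * t

2*q+odd≢odd*even : ∀ {m t} q → m % 2 ≡ 1 → t % 2 ≡ 0 → 2 * q + m ≢ m * t
2*q+odd≢odd*even {m} {t} q m-odd t-even 2q+m≡mt = 0≢1+n (begin
  0                        ≡⟨ cong (_% 2) (sym (*-zeroʳ (m % 2))) ⟩
  (m % 2 * 0) % 2          ≡⟨ cong (λ r → (m % 2 * r) % 2) (sym t-even) ⟩
  (m % 2 * (t % 2)) % 2    ≡⟨ sym (%-distribˡ-* m t 2) ⟩
  (m * t) % 2              ≡⟨ cong (_% 2) (sym 2q+m≡mt) ⟩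
  (2 * q + m) % 2          ≡⟨ cong (_% 2) (trans (+-comm (2 * q) m) (cong (m +_) (*-comm 2 q))) ⟩
  (m + q * 2) % 2          ≡⟨ [m+kn]%n≡m%n m q 2 ⟩
  m % 2                    ≡⟨ m-odd ⟩
  1                        ∎)

lemma5p7 : (m t : ℕ) → .{{_ : NonZero m}} → .{{_ : NonZero t}} →
           m % 2 ≡ 1 → t % 2 ≡ 0 → (nz : NonZero (m * t)) →
           (D : Fin 3 → Fin (m * (t ∸ 1)) → Fin (m * t)) →
           ¬ IsCHDM 3 m t {{nz}} D
lemma5p7 m t m-odd t-even nz D chdm = 2*q+odd≢odd*even {m} {t} q m-odd t-even 2q+m≡mt
  where
  mt∣N : m * t ∣ sumNonMultiples t (m * t)
  mt∣N = divides-sumNonMultiples {w = m} {t} {{nz}} D chdm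
           zero (suc zero) (suc (suc zero)) (λ ()) (λ ()) (λ ())
  q = proj₁ (mt∣sumNonMultiples⇒mt∸m-even m t {{nz}} mt∣N)
  2q+m≡mt : 2 * q + m ≡ m * t
  2q+m≡mt = proj₂ (mt∣sumNonMultiples⇒mt∸m-even m t {{nz}} mt∣N)
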